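{- Suppose there is a regular annotated $\infty$-proof of an annotated sequent $\Sigma;\Gamma\Rightarrow_s\Delta$. Then $\Sigma;\emptyset\vdash\bigwedge\Gamma\to\bigvee\Delta$.
   Context: Formulas are built from propositional variables and $\bot$ by $\to$, $\Box$, $\Box^+$ ($\neg A:=A\to\bot$, $\top:=\neg\bot$, $A\wedge B:=\neg(A\to\neg B)$, $A\vee B:=\neg A\to B$); $\bigwedge\Gamma,\bigvee\Delta$ are conjunction/disjunction of elements ($\bigwedge\emptyset=\top$, $\bigvee\emptyset=\bot$). $\mathsf{K}^+$: axioms classical tautologies, $\Box(A\to B)\to(\Box A\to\Box B)$, $\Box^+(A\to B)\to(\Box^+A\to\Box^+B)$, $\Box^+A\to\Box A\wedge\Box\Box^+A$, $\Box A\wedge\Box^+(A\to\Box A)\to\Box^+A$; rules ($\mathsf{mp}$) and ($\mathsf{nec}$): from $A$ infer $\Box^+A$. For a finite derivation built by these rules, an assumption leaf (not an axiom) is boxed if the path from the root to it passes through ($\mathsf{nec}$); $\Sigma;\Gamma\vdash A$ means there is such a derivation of $A$ with boxed assumption leaves in $\Sigma$ and non-boxed ones in $\Gamma$. An annotated sequent is $\Sigma;\Gamma\Rightarrow_s\Delta$ where $\Gamma,\Delta$ are finite multisets, $\Sigma$ a set of formulas, and $s$ is a formula or the sign $\circ$; if $s$ is a formula then $\Box^+s\in\Delta$. Annotated rules: initial sequents $\Sigma;\Gamma,p\Rightarrow_s p,\Delta$ and $\Sigma;\Gamma,\bot\Rightarrow_s\Delta$; ($\to_L$): from $\Sigma;\Gamma,B\Rightarrow_s\Delta$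 and $\Sigma;\Gamma\Rightarrow_s A,\Delta$ infer $\Sigma;\Gamma,A\to B\Rightarrow_s\Delta$; ($\to_R$): from $\Sigma;\Gamma,A\Rightarrow_s B,\Delta$ infer $\Sigma;\Gamma\Rightarrow_s A\to B,\Delta$; ($\mathsf{cut}$): from $\Sigma;\Gamma\Rightarrow_s\Delta,A$ and $\Sigma;A,\Gamma\Rightarrow_s\Delta$ infer $\Sigma;\Gamma\Rightarrow_s\Delta$; ($\Box$): from $\Sigma;\Sigma_0,\Lambda,\Pi,\Box^+\Pi\Rightarrow_\circ A$ infer $\Sigma;\Phi,\Box\Lambda,\Box^+\Pi\Rightarrow_s\Box A,\Psi$; ($\Box^+$): from left premise $\Sigma;\Sigma_0,\Lambda,\Pi,\Box^+\Pi\Rightarrow_\circ A$ and right premise $\Sigma;\Sigma_0,\Lambda,\Pi,\Box^+\Pi\Rightarrow_A\Box^+A$ infer $\Sigma;\Phi,\Box\Lambda,\Box^+\Pi\Rightarrow_s\Box^+A,\Psi$; $\Sigma_0$ a finite subset of $\Sigma$. An annotated $\infty$-proof is a possibly infinite tree of annotated sequents built by annotated rules, all leaves annotated initial sequents, such that every infinite branch has a tail in which all sequents carry the same formula annotation and which passes through right premises of ($\Box^+$) infinitely many times. It is regular if it has only finitely many non-isomorphic subtrees (isomorphism respecting annotations). -}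

module Defs where

open import Data.Nat using (ℕ; _≤_)
open import Data.Bool using (Bool; true; false; if_then_else_)
open import Data.Fin using (Fin; zero; suc; toℕ)
open import Data.List using (List; []; _∷_; _++_; map; [_]; _∷ʳ_)
open import Data.List.Membership.Propositional using (_∈_)
open import Data.List.Relation.Unary.All using (All)
open import Data.List.Relation.Unary.Unique.Propositional using (Unique)
open import Data.List.Relation.Binary.Permutation.Propositional using (_↭_)
open import Data.Maybe using (Maybe; just; nothing)
open import Data.Product using (Σ; _×_; _,_; ∃; ∃-syntax)
open import Data.Empty renaming (⊥ to Empty)
open import Data.Unit using (⊤; tt)
open import Relation.Binary.PropositionalEquality using (_≡_)

infixr 5 _⇒_

data Fm : Set where
  var : ℕ → Fm
  ⊥'  : Fm
  _⇒_ : Fm → Fm → Fm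
  □   : Fm → Fm
  □⁺  : Fm → Fm

¬' : Fm → Fm
¬' A = A ⇒ ⊥'

⊤' : Fm
⊤' = ¬' ⊥'

_∧'_ : Fm → Fm → Fm
A ∧' B = ¬' (A ⇒ ¬' B)

_∨'_ : Fm → Fm → Fm
A ∨' B = ¬' A ⇒ B

⋀ : List Fm → Fm
⋀ []      = ⊤'
⋀ (A ∷ Γ) = A ∧' ⋀ Γ

⋁ : List Fm → Fm
⋁ []      = ⊥'
⋁ (A ∷ Δ) = A ∨' ⋁ Δ

-- Classical tautologies: true under every boolean valuation that treats
-- variables, □B and □⁺B as propositional atoms.

⟦_⟧ : Fm → (Fm → Bool) → Bool
⟦ var n ⟧ v = v (var n)
⟦ ⊥' ⟧    v = false
⟦ A ⇒ B ⟧ v = if ⟦ A ⟧ v then ⟦ B ⟧ v else true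
⟦ □ A ⟧   v = v (□ A)
⟦ □⁺ A ⟧  v = v (□⁺ A)

Tautology : Fm → Set
Tautology A = (v : Fm → Bool) → ⟦ A ⟧ v ≡ true

data Axiom : Fm → Set where
  taut  : ∀ {A} → Tautology A → Axiom A
  K□    : ∀ A B → Axiom (□ (A ⇒ B) ⇒ (□ A ⇒ □ B))
  K□⁺   : ∀ A B → Axiom (□⁺ (A ⇒ B) ⇒ (□⁺ A ⇒ □⁺ B))
  unfold : ∀ A → Axiom (□⁺ A ⇒ (□ A ∧' □ (□⁺ A)))
  induct : ∀ A → Axiom ((□ A ∧' □⁺ (A ⇒ □ A)) ⇒ □⁺ A)

-- Der Sg G A : a finite derivation of A whose boxed assumption leaves
-- (those below an application of nec) lie in Sg and whose non-boxed
-- assumption leaves lie in G.  Inside a nec-subderivation every leaf is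
-- boxed, hence both kinds of leaves there must lie in Sg.
data Der (Sg : Fm → Set) : (Fm → Set) → Fm → Set₁ where
  ax  : ∀ {G A} → Axiom A → Der Sg G A
  hyp : ∀ {G A} → G A → Der Sg G A
  mp  : ∀ {G A B} → Der Sg G (A ⇒ B) → Der Sg G A → Der Sg G B
  nec : ∀ {G A} → Der Sg Sg A → Der Sg G (□⁺ A)

_︔_⊢_ : (Fm → Set) → (Fm → Set) → Fm → Set₁
Sg ︔ G ⊢ A = Der Sg G A

∅ : Fm → Set
∅ _ = Empty

data Ann : Set where
  ∘  : Ann
  fm : Fm → Ann

record ASeq : Set where
  constructor ⟨_⇒[_]_⟩
  field
    ante : List Fm
    ann  : Ann
    succ : List Fm
open ASeq public

WF : ASeq → Set
WF ⟨ Γ ⇒[ ∘ ]    Δ ⟩ = ⊤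
WF ⟨ Γ ⇒[ fm A ] Δ ⟩ = □⁺ A ∈ Δ

_≈ˢ_ : ASeq → ASeq → Set
S ≈ˢ T = (ante S ↭ ante T) × (ann S ≡ ann T) × (succ S ↭ succ T)

data Tag : Set where
  init impL impR cut box box⁺ : Tag

-- Rule Sg t C Ps : C follows from premises Ps (in order) by an
-- annotated rule of kind t; principal formulas are written in front,
-- arbitrary positions are allowed via ≈ˢ in the tree condition below.
data Rule (Sg : Fm → Set) : Tag → ASeq → List ASeq → Set where
  initp  : ∀ n Γ Δ s → Rule Sg init ⟨ var n ∷ Γ ⇒[ s ] var n ∷ Δ ⟩ []
  init⊥  : ∀ Γ Δ s → Rule Sg init ⟨ ⊥' ∷ Γ ⇒[ s ] Δ ⟩ []
  →L     : ∀ A B Γ Δ s →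
           Rule Sg impL ⟨ (A ⇒ B) ∷ Γ ⇒[ s ] Δ ⟩
                        (⟨ B ∷ Γ ⇒[ s ] Δ ⟩ ∷ ⟨ Γ ⇒[ s ] A ∷ Δ ⟩ ∷ [])
  →R     : ∀ A B Γ Δ s →
           Rule Sg impR ⟨ Γ ⇒[ s ] (A ⇒ B) ∷ Δ ⟩
                        (⟨ A ∷ Γ ⇒[ s ] B ∷ Δ ⟩ ∷ [])
  cutR   : ∀ A Γ Δ s →
           Rule Sg cut ⟨ Γ ⇒[ s ] Δ ⟩
                       (⟨ Γ ⇒[ s ] Δ ++ [ A ] ⟩ ∷ ⟨ A ∷ Γ ⇒[ s ] Δ ⟩ ∷ [])
  □R     : ∀ (Σ₀ : List Fm) → All Sg Σ₀ → Unique Σ₀ →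
           ∀ A Φ Λ Π Ψ s →
           Rule Sg box ⟨ Φ ++ map □ Λ ++ map □⁺ Π ⇒[ s ] □ A ∷ Ψ ⟩
                       (⟨ Σ₀ ++ Λ ++ Π ++ map □⁺ Π ⇒[ ∘ ] [ A ] ⟩ ∷ [])
  □⁺R    : ∀ (Σ₀ : List Fm) → All Sg Σ₀ → Unique Σ₀ →
           ∀ A Φ Λ Π Ψ s →
           Rule Sg box⁺ ⟨ Φ ++ map □ Λ ++ map □⁺ Π ⇒[ s ] □⁺ A ∷ Ψ ⟩
                        (⟨ Σ₀ ++ Λ ++ Π ++ map □⁺ Π ⇒[ ∘ ] [ A ] ⟩
                         ∷ ⟨ Σ₀ ++ Λ ++ Π ++ map □⁺ Π ⇒[ fm A ] [ □⁺ A ] ⟩ ∷ [])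

-- Nodes are addressed by finite words over Fin 2 (child 0 = left/first
-- premise, child 1 = right/second premise); a tree is a labelling of
-- addresses, `nothing` meaning "no node here".

Addr : Set
Addr = List (Fin 2)

Label : Set
Label = ASeq × Tag

Tree : Set
Tree = Addr → Maybe Label

nth : {A : Set} → List A → ℕ → Maybe A
nth []       _       = nothing
nth (x ∷ xs) ℕ.zero  = just x
nth (x ∷ xs) (ℕ.suc n) = nth xs n

Matches : Maybe Label → Maybe ASeq → Set
Matches nothing        nothing  = ⊤
Matches (just (S , _)) (just P) = S ≈ˢ P
Matches _              _        = Empty

LabEq : Maybe Label → Maybe Label → Set
LabEq nothing        nothing         = ⊤
LabEq (just (S , t)) (just (S' , t')) = (S ≈ˢ S') × (t ≡ t')
LabEq _              _               = Empty

LocallyCorrect : (Fm → Set) → Tree → Set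
LocallyCorrect Sg T =
  (∀ α S t → T α ≡ just (S , t) →
     WF S ×
     ∃[ C ] ∃[ Ps ] (Rule Sg t C Ps × (S ≈ˢ C) ×
        (∀ (i : Fin 2) → Matches (T (α ∷ʳ i)) (nth Ps (toℕ i)))))
  × (∀ α (i : Fin 2) → T α ≡ nothing → T (α ∷ʳ i) ≡ nothing)

prefix : (ℕ → Fin 2) → ℕ → Addr
prefix f ℕ.zero    = []
prefix f (ℕ.suc n) = prefix f n ∷ʳ f n

annAt : Maybe Label → Maybe Ann
annAt nothing        = nothing
annAt (just (S , _)) = just (ann S)

tagAt : Maybe Label → Maybe Tag
tagAt nothing        = nothing
tagAt (just (_ , t)) = just t

Defined : Tree → Addr → Set
Defined T α = ∃[ L ] (T α ≡ just L)

GoodBranches : Tree → Set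
GoodBranches T =
  ∀ (f : ℕ → Fin 2) → (∀ n → Defined T (prefix f n)) →
    ∃[ k ] ∃[ A ]
      ((∀ n → k ≤ n → annAt (T (prefix f n)) ≡ just (fm A)) ×
       (∀ m → ∃[ n ] (m ≤ n × k ≤ n ×
            tagAt (T (prefix f n)) ≡ just box⁺ × f n ≡ suc zero)))

∞Proof : (Fm → Set) → ASeq → Tree → Set
∞Proof Sg R T =
  (∃[ t ] (T [] ≡ just (R , t))) × LocallyCorrect Sg T × GoodBranches T

Iso : Tree → Addr → Addr → Set
Iso T α β = ∀ γ → LabEq (T (α ++ γ)) (T (β ++ γ))

Regular : Tree → Set
Regular T = ∃[ reps ] (∀ α → Defined T α → ∃[ β ] (β ∈ reps × Iso T α β))

-- Regularity turns the ∞-proof into a finite graph on representative subtrees, and by GoodBranches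
-- every cycle of this graph keeps one formula annotation A and passes through a right premise of
-- (□⁺).  Every annotated rule is sound for the formula ⋀Γ → ⋁Δ ∨ E.  A node annotated A is
-- translated through its whole A-annotated region, leaving the right premises of (□⁺) annotated A
-- open as buds y with obligations □(A ∧ χ_y), χ_y = ⋀Γ_y ∧ (⋁Δ_y → □⁺A).  Only finitely many such
-- regions exist, and the induction axiom applied to the invariant ⋁_y χ_y ∨ □⁺A discharges all
-- obligations at once.  Everywhere else the translation simply recurses into the premises; a
-- recursion path revisiting a representative would be a cycle violating GoodBranches, so the
-- recursion is well founded.

module Submission where

open import Defs
open import Data.Bool using (Bool; true; false; if_then_else_)
open import Data.Empty renaming (⊥ to Empty) using (⊥-elim)
open import Data.Fin using (Fin; zero; suc; toℕ)
import Data.Fin.Properties as Fin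
open import Data.List using (List; []; _∷_; _++_; map; [_]; _∷ʳ_; length)
open import Data.List.Properties using (++-assoc; ++-identityʳ; ≡-dec)
open import Data.List.Membership.Propositional using (_∈_; lose)
open import Data.List.Relation.Unary.All using (All; []; _∷_)
import Data.List.Relation.Unary.All as All
import Data.List.Relation.Unary.All.Properties as All
open import Data.List.Relation.Unary.Any using (Any; here; there; any?; satisfied)
import Data.List.Relation.Unary.Any as Any
import Data.List.Relation.Unary.Any.Properties as Any
open import Data.List.Relation.Binary.Permutation.Propositional using (_↭_; ↭-refl; ↭-sym; ↭-trans)
open import Data.List.Relation.Binary.Permutation.Propositional.Properties using (All-resp-↭; Any-resp-↭)
open import Data.Maybe using (Maybe; just; nothing)
open import Data.Maybe.Properties using (just-injective)
open import Data.Nat using (ℕ; zero; suc; _+_; _≤_; s≤s)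
import Data.Nat as ℕ
open import Data.Nat.Properties using (≤-refl; ≤-trans; +-suc; +-identityʳ; m≤m+n; m≤n+m; n≤1+n; m≤n⇒∃[o]m+o≡n)
open import Data.Product using (Σ; _×_; _,_; proj₁; proj₂; ∃-syntax)
open import Data.Sum using (_⊎_; inj₁; inj₂; [_,_]′)
import Data.Sum as Sum
open import Data.Unit using (tt)
open import Relation.Binary.PropositionalEquality using (_≡_; refl; sym; trans; cong; subst; subst₂)
open import Relation.Nullary using (¬_; Dec; yes; no)
open import Relation.Nullary.Decidable using (map′; _×-dec_)

module Semantics where

  record _⊨_ (v : Fm → Bool) (A : Fm) : Set where
    constructor holds
    field truth : ⟦ A ⟧ v ≡ true
  open _⊨_

  ⊨-dec : ∀ v A → v ⊨ A ⊎ (v ⊨ A → Empty)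
  ⊨-dec v A with ⟦ A ⟧ v in eq
  ... | true  = inj₁ (holds eq)
  ... | false = inj₂ (λ { (holds p) → false≢true (trans (sym eq) p) })
    where
      false≢true : false ≡ true → Empty
      false≢true ()

  ⇒-intro : ∀ {v A B} → (v ⊨ A → v ⊨ B) → v ⊨ (A ⇒ B)
  ⇒-intro {v} {A} {B} f with ⟦ A ⟧ v in eq
  ... | true  = holds (trans (cong (λ b → if b then ⟦ B ⟧ v else true) eq) (truth (f (holds eq))))
  ... | false = holds (cong (λ b → if b then ⟦ B ⟧ v else true) eq)

  ⇒-elim : ∀ {v A B} → v ⊨ (A ⇒ B) → v ⊨ A → v ⊨ B
  ⇒-elim {v} {B = B} (holds p) (holds q) =
    holds (trans (sym (cong (λ b → if b then ⟦ B ⟧ v else true) q)) p)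

  ⊥-false : ∀ {v} {X : Set} → v ⊨ ⊥' → X
  ⊥-false (holds ())

  ¬-intro : ∀ {v A} → (v ⊨ A → Empty) → v ⊨ ¬' A
  ¬-intro f = ⇒-intro (λ a → ⊥-elim (f a))

  ¬-elim : ∀ {v A} → v ⊨ ¬' A → v ⊨ A → Empty
  ¬-elim p q = ⊥-false (⇒-elim p q)

  ⊨-stable : ∀ {v A} → ((v ⊨ A → Empty) → Empty) → v ⊨ A
  ⊨-stable {v} {A} f with ⊨-dec v A
  ... | inj₁ a  = a
  ... | inj₂ na = ⊥-elim (f na)

  ∧-intro : ∀ {v A B} → v ⊨ A → v ⊨ B → v ⊨ (A ∧' B)
  ∧-intro a b = ¬-intro (λ f → ¬-elim (⇒-elim f a) b)

  ∧-proj₁ : ∀ {v A B} → v ⊨ (A ∧' B) → v ⊨ A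
  ∧-proj₁ p = ⊨-stable (λ na → ¬-elim p (⇒-intro (λ a → ⊥-elim (na a))))

  ∧-proj₂ : ∀ {v} A {B} → v ⊨ (A ∧' B) → v ⊨ B
  ∧-proj₂ A p = ⊨-stable (λ nb → ¬-elim p (⇒-intro (λ _ → ¬-intro nb)))

  ∨-inj₁ : ∀ {v A B} → v ⊨ A → v ⊨ (A ∨' B)
  ∨-inj₁ a = ⇒-intro (λ na → ⊥-elim (¬-elim na a))

  ∨-inj₂ : ∀ {v} A {B} → v ⊨ B → v ⊨ (A ∨' B)
  ∨-inj₂ A b = ⇒-intro (λ _ → b)

  ∨-cases : ∀ {v} A {B} → v ⊨ (A ∨' B) → v ⊨ A ⊎ v ⊨ B
  ∨-cases {v} A p with ⊨-dec v A
  ... | inj₁ a  = inj₁ a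
  ... | inj₂ na = inj₂ (⇒-elim p (¬-intro na))

  ⋀⇒All : ∀ {v} Γ → v ⊨ ⋀ Γ → All (v ⊨_) Γ
  ⋀⇒All []      _ = []
  ⋀⇒All (A ∷ Γ) p = ∧-proj₁ p ∷ ⋀⇒All Γ (∧-proj₂ A p)

  All⇒⋀ : ∀ {v} Γ → All (v ⊨_) Γ → v ⊨ ⋀ Γ
  All⇒⋀ []      []       = ¬-intro (λ ())
  All⇒⋀ (A ∷ Γ) (a ∷ as) = ∧-intro a (All⇒⋀ Γ as)

  ⋁⇒Any : ∀ {v} Δ → v ⊨ ⋁ Δ → Any (v ⊨_) Δ
  ⋁⇒Any []      p = ⊥-false p
  ⋁⇒Any (A ∷ Δ) p = Sum.[ here , (λ q → there (⋁⇒Any Δ q)) ]′ (∨-cases A p)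

  Any⇒⋁ : ∀ {v} Δ → Any (v ⊨_) Δ → v ⊨ ⋁ Δ
  Any⇒⋁ (A ∷ Δ) (here a)  = ∨-inj₁ a
  Any⇒⋁ (A ∷ Δ) (there p) = ∨-inj₂ A (Any⇒⋁ Δ p)

  ⋁-singleton : ∀ {v A} → v ⊨ ⋁ [ A ] → v ⊨ A
  ⋁-singleton {A = A} p with ⋁⇒Any [ A ] p
  ... | here a = a

open Semantics

-- Propositional steps are justified semantically, through the tautology axiom.
module Hilbert (Sg : Fm → Set) where

  ⊢_ : Fm → Set₁
  ⊢ A = Sg ︔ ∅ ⊢ A

  weaken : ∀ {G A} → ⊢ A → Der Sg G A
  weaken (ax a)   = ax a
  weaken (hyp ())
  weaken (mp d e) = mp (weaken d) (weaken e)
  weaken (nec d)  = nec d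

  valid : ∀ {Q} → (∀ v → v ⊨ Q) → ⊢ Q
  valid f = ax (taut (λ v → _⊨_.truth (f v)))

  valid₁ : ∀ {P Q} → ⊢ P → (∀ v → v ⊨ P → v ⊨ Q) → ⊢ Q
  valid₁ d f = mp (valid (λ v → ⇒-intro (f v))) d

  valid₂ : ∀ {P Q R} → ⊢ P → ⊢ Q → (∀ v → v ⊨ P → v ⊨ Q → v ⊨ R) → ⊢ R
  valid₂ d e f = mp (mp (valid (λ v → ⇒-intro (λ p → ⇒-intro (f v p)))) d) e

  valid₃ : ∀ {P Q R U} → ⊢ P → ⊢ Q → ⊢ R → (∀ v → v ⊨ P → v ⊨ Q → v ⊨ R → v ⊨ U) → ⊢ U
  valid₃ d e g f =
    mp (mp (mp (valid (λ v → ⇒-intro (λ p → ⇒-intro (λ q → ⇒-intro (f v p q))))) d) e) g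

  ⇒-trans : ∀ {A B C} → ⊢ (A ⇒ B) → ⊢ (B ⇒ C) → ⊢ (A ⇒ C)
  ⇒-trans d e = valid₂ d e (λ v p q → ⇒-intro (λ a → ⇒-elim q (⇒-elim p a)))

  ⋁-elim : ∀ {R} Ys → All (λ Y → ⊢ (Y ⇒ R)) Ys → ⊢ (⋁ Ys ⇒ R)
  ⋁-elim []       []       = valid (λ v → ⇒-intro ⊥-false)
  ⋁-elim (Y ∷ Ys) (d ∷ ds) =
    valid₂ d (⋁-elim Ys ds) (λ v p q → ⇒-intro (λ c → [ ⇒-elim p , ⇒-elim q ]′ (∨-cases Y c)))

  necessitation : ∀ {A} → ⊢ A → ⊢ □⁺ A
  necessitation d = nec (weaken d)

  □⁺⇒□ : ∀ {A} → ⊢ (□⁺ A ⇒ □ A)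
  □⁺⇒□ {A} = valid₁ (ax (unfold A)) (λ v p → ⇒-intro (λ a → ∧-proj₁ (⇒-elim p a)))

  □⁺⇒□□⁺ : ∀ {A} → ⊢ (□⁺ A ⇒ □ (□⁺ A))
  □⁺⇒□□⁺ {A} =
    valid₁ (ax (unfold A)) (λ v p → ⇒-intro (λ a → ∧-proj₂ (□ A) (⇒-elim p a)))

  □-necessitation : ∀ {A} → ⊢ A → ⊢ □ A
  □-necessitation d = mp □⁺⇒□ (necessitation d)

  □-assumption : ∀ {A} → Sg A → ⊢ □ A
  □-assumption a = mp □⁺⇒□ (nec (hyp a))

  □-mono : ∀ {A B} → ⊢ (A ⇒ B) → ⊢ (□ A ⇒ □ B)
  □-mono d = mp (ax (K□ _ _)) (□-necessitation d)

  □⁺-mono : ∀ {A B} → ⊢ (A ⇒ B) → ⊢ (□⁺ A ⇒ □⁺ B)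
  □⁺-mono d = mp (ax (K□⁺ _ _)) (necessitation d)

  □-lift : ∀ Xs {Y} → ⊢ (⋀ Xs ⇒ Y) → ⊢ (⋀ (map □ Xs) ⇒ □ Y)
  □-lift [] d =
    valid₁ (□-necessitation (valid₁ d (λ v p → ⇒-elim p (All⇒⋀ [] []))))
           (λ v p → ⇒-intro (λ _ → p))
  □-lift (X ∷ Xs) {Y} d =
    valid₂ (□-lift Xs (valid₁ d curry)) (ax (K□ X Y))
      (λ v p k → ⇒-intro (λ c →
        let □s = ⋀⇒All (□ X ∷ map □ Xs) c in
        ⇒-elim (⇒-elim k (⇒-elim p (All⇒⋀ (map □ Xs) (All.tail □s)))) (All.head □s)))
    where
      curry : ∀ v → v ⊨ (⋀ (X ∷ Xs) ⇒ Y) → v ⊨ (⋀ Xs ⇒ (X ⇒ Y))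
      curry v p = ⇒-intro (λ q → ⇒-intro (λ x → ⇒-elim p (∧-intro x q)))

  -- The induction axiom applied to the invariant A ∧ C.
  □⁺-induction : ∀ {C A} → ⊢ (C ⇒ □ (A ∧' C)) → ⊢ (C ⇒ □⁺ A)
  □⁺-induction {C} {A} d = ⇒-trans C⇒□⁺[A∧C] (□⁺-mono (valid (λ v → ⇒-intro ∧-proj₁)))
    where
      A∧C⇒□[A∧C] : ⊢ ((A ∧' C) ⇒ □ (A ∧' C))
      A∧C⇒□[A∧C] = valid₁ d (λ v p → ⇒-intro (λ ac → ⇒-elim p (∧-proj₂ A ac)))
      C⇒□⁺[A∧C] : ⊢ (C ⇒ □⁺ (A ∧' C))
      C⇒□⁺[A∧C] = valid₃ d (necessitation A∧C⇒□[A∧C]) (ax (induct (A ∧' C)))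
        (λ v p n k → ⇒-intro (λ c → ⇒-elim k (∧-intro (⇒-elim p c) n)))

  □⁺⇒□[∧□⁺] : ∀ {A} → ⊢ (□⁺ A ⇒ □ (A ∧' □⁺ A))
  □⁺⇒□[∧□⁺] {A} =
    valid₂ (ax (unfold A)) (□-lift (A ∷ □⁺ A ∷ []) (valid (λ v → ⇒-intro pair)))
      (λ v u b → ⇒-intro (λ p → ⇒-elim b (All⇒⋀ (□ A ∷ □ (□⁺ A) ∷ [])
         (∧-proj₁ (⇒-elim u p) ∷ ∧-proj₂ (□ A) (⇒-elim u p) ∷ []))))
    where
      pair : ∀ {v} → v ⊨ ⋀ (A ∷ □⁺ A ∷ []) → v ⊨ (A ∧' □⁺ A)
      pair p = ∧-intro (∧-proj₁ p) (∧-proj₁ (∧-proj₂ A p))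

  □[∧□⁺]⇒□⁺ : ∀ {A} → ⊢ (□ (A ∧' □⁺ A) ⇒ □⁺ A)
  □[∧□⁺]⇒□⁺ {A} = □⁺-induction (□-mono (valid₁ □⁺⇒□[∧□⁺]
    (λ v g → ⇒-intro (λ p → ∧-intro (∧-proj₁ p) (⇒-elim g (∧-proj₂ A p))))))

  -- The common invariant of a finite loop of □⁺-obligations is ⋁ Xs ∨ □⁺ A.
  □⁺-from-loop : ∀ A Xs → All (λ X → ⊢ (X ⇒ (□⁺ A ∨' □ (A ∧' ⋁ Xs)))) Xs →
                 ⊢ (□ (A ∧' ⋁ Xs) ⇒ □⁺ A)
  □⁺-from-loop A Xs ds = ⇒-trans (□-mono (valid₁ C⇒□⁺A weaken-A∧L)) □[∧□⁺]⇒□⁺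
    where
      L C : Fm
      L = ⋁ Xs
      C = L ∨' □⁺ A
      L⇒step : ⊢ (L ⇒ (□⁺ A ∨' □ (A ∧' L)))
      L⇒step = ⋁-elim Xs ds
      □[A∧L]⇒□[A∧C] : ⊢ (□ (A ∧' L) ⇒ □ (A ∧' C))
      □[A∧L]⇒□[A∧C] =
        □-mono (valid (λ v → ⇒-intro (λ p → ∧-intro (∧-proj₁ p) (∨-inj₁ (∧-proj₂ A p)))))
      □[A∧□⁺A]⇒□[A∧C] : ⊢ (□ (A ∧' □⁺ A) ⇒ □ (A ∧' C))
      □[A∧□⁺A]⇒□[A∧C] =
        □-mono (valid (λ v → ⇒-intro (λ p → ∧-intro (∧-proj₁ p) (∨-inj₂ L (∧-proj₂ A p)))))
      C⇒□⁺A : ⊢ (C ⇒ □⁺ A)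
      C⇒□⁺A = □⁺-induction (valid₃ L⇒step (⇒-trans □⁺⇒□[∧□⁺] □[A∧□⁺A]⇒□[A∧C]) □[A∧L]⇒□[A∧C]
        (λ v p q r → ⇒-intro (λ c →
          [ (λ l → [ ⇒-elim q , ⇒-elim r ]′ (∨-cases (□⁺ A) (⇒-elim p l))) , ⇒-elim q ]′
            (∨-cases L c))))
      weaken-A∧L : ∀ v → v ⊨ (C ⇒ □⁺ A) → v ⊨ ((A ∧' L) ⇒ (A ∧' □⁺ A))
      weaken-A∧L v p = ⇒-intro (λ q → ∧-intro (∧-proj₁ q) (⇒-elim p (∨-inj₁ (∧-proj₂ A q))))

module FormulaEquality where

  _≟ᶠ_ : (A B : Fm) → Dec (A ≡ B)
  var m   ≟ᶠ var n   = map′ (cong var) (λ { refl → refl }) (m ℕ.≟ n)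
  ⊥'      ≟ᶠ ⊥'      = yes refl
  (A ⇒ B) ≟ᶠ (C ⇒ D) =
    map′ (λ { (refl , refl) → refl }) (λ { refl → refl , refl }) ((A ≟ᶠ C) ×-dec (B ≟ᶠ D))
  □ A     ≟ᶠ □ B     = map′ (cong □) (λ { refl → refl }) (A ≟ᶠ B)
  □⁺ A    ≟ᶠ □⁺ B    = map′ (cong □⁺) (λ { refl → refl }) (A ≟ᶠ B)
  var _   ≟ᶠ ⊥'      = no λ ()
  var _   ≟ᶠ (_ ⇒ _) = no λ ()
  var _   ≟ᶠ □ _     = no λ ()
  var _   ≟ᶠ □⁺ _    = no λ ()
  ⊥'      ≟ᶠ var _   = no λ ()
  ⊥'      ≟ᶠ (_ ⇒ _) = no λ ()
  ⊥'      ≟ᶠ □ _     = no λ ()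
  ⊥'      ≟ᶠ □⁺ _    = no λ ()
  (_ ⇒ _) ≟ᶠ var _   = no λ ()
  (_ ⇒ _) ≟ᶠ ⊥'      = no λ ()
  (_ ⇒ _) ≟ᶠ □ _     = no λ ()
  (_ ⇒ _) ≟ᶠ □⁺ _    = no λ ()
  □ _     ≟ᶠ var _   = no λ ()
  □ _     ≟ᶠ ⊥'      = no λ ()
  □ _     ≟ᶠ (_ ⇒ _) = no λ ()
  □ _     ≟ᶠ □⁺ _    = no λ ()
  □⁺ _    ≟ᶠ var _   = no λ ()
  □⁺ _    ≟ᶠ ⊥'      = no λ ()
  □⁺ _    ≟ᶠ (_ ⇒ _) = no λ ()
  □⁺ _    ≟ᶠ □ _     = no λ ()

  _≟fm_ : ∀ s A → Dec (s ≡ fm A)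
  ∘    ≟fm A = no λ ()
  fm B ≟fm A = map′ (cong fm) (λ { refl → refl }) (B ≟ᶠ A)

open FormulaEquality

boxPremise : List Fm → List Fm → List Fm → List Fm
boxPremise Σ₀ Λ Π = Σ₀ ++ Λ ++ Π ++ map □⁺ Π

boxConclusion : List Fm → List Fm → List Fm → List Fm
boxConclusion Φ Λ Π = Φ ++ map □ Λ ++ map □⁺ Π

module SequentRules (Sg : Fm → Set) where
  open Hilbert Sg

  -- E is an extra disjunct of the succedent, left open for pending □⁺-obligations.
  Seq : List Fm → List Fm → Fm → Fm
  Seq Γ Δ E = ⋀ Γ ⇒ (⋁ Δ ∨' E)

  seq-intro : ∀ {v Γ Δ E} → (All (v ⊨_) Γ → Any (v ⊨_) Δ ⊎ v ⊨ E) → v ⊨ Seq Γ Δ E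
  seq-intro {Γ = Γ} {Δ} f =
    ⇒-intro (λ g → [ (λ a → ∨-inj₁ (Any⇒⋁ Δ a)) , ∨-inj₂ (⋁ Δ) ]′ (f (⋀⇒All Γ g)))

  seq-elim : ∀ {v Γ Δ E} → v ⊨ Seq Γ Δ E → All (v ⊨_) Γ → Any (v ⊨_) Δ ⊎ v ⊨ E
  seq-elim {Γ = Γ} {Δ} p a = Sum.map₁ (⋁⇒Any Δ) (∨-cases (⋁ Δ) (⇒-elim p (All⇒⋀ Γ a)))

  seq-resp-↭ : ∀ {Γ Γ′ Δ Δ′ E} → Γ ↭ Γ′ → Δ ↭ Δ′ → ⊢ Seq Γ Δ E → ⊢ Seq Γ′ Δ′ E
  seq-resp-↭ Γ↭ Δ↭ p = valid₁ p (λ v q → seq-intro (λ a →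
    Sum.map₁ (Any-resp-↭ Δ↭) (seq-elim q (All-resp-↭ (↭-sym Γ↭) a))))

  ⋀⇒⋁-resp-↭ : ∀ {Γ Γ′ Δ Δ′} → Γ ↭ Γ′ → Δ ↭ Δ′ → ⊢ (⋀ Γ ⇒ ⋁ Δ) → ⊢ (⋀ Γ′ ⇒ ⋁ Δ′)
  ⋀⇒⋁-resp-↭ {Γ} {Γ′} {Δ} {Δ′} Γ↭ Δ↭ p = valid₁ p (λ v q → ⇒-intro (λ a →
    Any⇒⋁ Δ′ (Any-resp-↭ Δ↭ (⋁⇒Any Δ
      (⇒-elim q (All⇒⋀ Γ (All-resp-↭ (↭-sym Γ↭) (⋀⇒All Γ′ a))))))))

  seq-resp-≈ˢ : ∀ {S S′ E} → S ≈ˢ S′ → ⊢ Seq (ante S) (succ S) E → ⊢ Seq (ante S′) (succ S′) E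
  seq-resp-≈ˢ (Γ↭ , _ , Δ↭) = seq-resp-↭ Γ↭ Δ↭

  seq-⊥ : ∀ {Γ Δ} → ⊢ Seq Γ Δ ⊥' → ⊢ (⋀ Γ ⇒ ⋁ Δ)
  seq-⊥ {Γ} {Δ} p = valid₁ p (λ v q → ⇒-intro (λ g →
    [ Any⇒⋁ Δ , ⊥-false ]′ (seq-elim q (⋀⇒All Γ g))))

  init-var-sound : ∀ n Γ Δ E → ⊢ Seq (var n ∷ Γ) (var n ∷ Δ) E
  init-var-sound n Γ Δ E =
    valid (λ v → seq-intro {Γ = var n ∷ Γ} {Δ = var n ∷ Δ} (λ { (a ∷ _) → inj₁ (here a) }))

  init-⊥-sound : ∀ Γ Δ E → ⊢ Seq (⊥' ∷ Γ) Δ E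
  init-⊥-sound Γ Δ E = valid (λ v → seq-intro {Γ = ⊥' ∷ Γ} {Δ = Δ} (λ { (a ∷ _) → ⊥-false a }))

  →L-sound : ∀ {A B Γ Δ E} → ⊢ Seq (B ∷ Γ) Δ E → ⊢ Seq Γ (A ∷ Δ) E → ⊢ Seq ((A ⇒ B) ∷ Γ) Δ E
  →L-sound {A} {B} {Γ} {Δ} p q =
    valid₂ p q (λ v p′ q′ →
      seq-intro {Γ = (A ⇒ B) ∷ Γ} {Δ = Δ} (λ { (ab ∷ g) → sound v p′ q′ ab g }))
    where
      sound : ∀ {A B Γ Δ E} v → v ⊨ Seq (B ∷ Γ) Δ E → v ⊨ Seq Γ (A ∷ Δ) E → v ⊨ (A ⇒ B) →
              All (v ⊨_) Γ → Any (v ⊨_) Δ ⊎ v ⊨ E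
      sound v p′ q′ ab g with seq-elim q′ g
      ... | inj₂ e         = inj₂ e
      ... | inj₁ (there d) = inj₁ d
      ... | inj₁ (here a)  = seq-elim p′ (⇒-elim ab a ∷ g)

  →R-sound : ∀ {A B Γ Δ E} → ⊢ Seq (A ∷ Γ) (B ∷ Δ) E → ⊢ Seq Γ ((A ⇒ B) ∷ Δ) E
  →R-sound p = valid₁ p (λ v p′ → seq-intro (sound v p′))
    where
      sound : ∀ {A B Γ Δ E} v → v ⊨ Seq (A ∷ Γ) (B ∷ Δ) E → All (v ⊨_) Γ →
              Any (v ⊨_) ((A ⇒ B) ∷ Δ) ⊎ v ⊨ E
      sound {A} v p′ g with ⊨-dec v A
      ... | inj₂ na = inj₁ (here (⇒-intro (λ a → ⊥-elim (na a))))
      ... | inj₁ a with seq-elim p′ (a ∷ g)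
      ...   | inj₂ e         = inj₂ e
      ...   | inj₁ (here b)  = inj₁ (here (⇒-intro (λ _ → b)))
      ...   | inj₁ (there d) = inj₁ (there d)

  cut-sound : ∀ {A Γ Δ E} → ⊢ Seq Γ (Δ ++ [ A ]) E → ⊢ Seq (A ∷ Γ) Δ E → ⊢ Seq Γ Δ E
  cut-sound {A} {Γ} {Δ} p q = valid₂ p q (λ v p′ q′ → seq-intro (sound v p′ q′))
    where
      sound : ∀ {E} v → v ⊨ Seq Γ (Δ ++ [ A ]) E → v ⊨ Seq (A ∷ Γ) Δ E → All (v ⊨_) Γ →
              Any (v ⊨_) Δ ⊎ v ⊨ E
      sound v p′ q′ g with seq-elim p′ g
      ... | inj₂ e = inj₂ e
      ... | inj₁ d with Any.++⁻ Δ d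
      ...   | inj₁ d′        = inj₁ d′
      ...   | inj₂ (here a)  = seq-elim q′ (a ∷ g)

  seq-absorb : ∀ {Γ Δ E B} → B ∈ Δ → ⊢ Seq Γ Δ E → ⊢ (E ⇒ B) → ⊢ (⋀ Γ ⇒ ⋁ Δ)
  seq-absorb {Γ} {Δ} B∈Δ p q = valid₂ p q (λ v p′ q′ → ⇒-intro (λ g →
    Any⇒⋁ Δ ([ (λ a → a) , (λ e → lose B∈Δ (⇒-elim q′ e)) ]′ (seq-elim p′ (⋀⇒All Γ g)))))

  seq-guard : ∀ {Γ Δ E B} → ⊢ Seq Γ Δ E → ⊢ ((⋀ Γ ∧' (⋁ Δ ⇒ B)) ⇒ (B ∨' E))
  seq-guard {Γ} {Δ} {B = B} p = valid₁ p (λ v p′ → ⇒-intro (λ c →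
    [ (λ a → ∨-inj₁ (⇒-elim (∧-proj₂ (⋀ Γ) c) (Any⇒⋁ Δ a))) , ∨-inj₂ B ]′
      (seq-elim p′ (⋀⇒All Γ (∧-proj₁ c)))))

  ⋀-map-⇒ : ∀ {f g : Fm → Fm} → (∀ x → ⊢ (f x ⇒ g x)) → ∀ xs → ⊢ (⋀ (map f xs) ⇒ ⋀ (map g xs))
  ⋀-map-⇒ h []                 = valid (λ v → ⇒-intro (λ p → p))
  ⋀-map-⇒ {f} {g} h (x ∷ xs) = valid₂ (h x) (⋀-map-⇒ h xs)
    (λ v p q → ⇒-intro (λ c → ∧-intro (⇒-elim p (∧-proj₁ c)) (⇒-elim q (∧-proj₂ (f x) c))))

  ⋀□-assumptions : ∀ {Σ₀} → All Sg Σ₀ → ⊢ ⋀ (map □ Σ₀)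
  ⋀□-assumptions []       = valid (λ v → All⇒⋀ [] [])
  ⋀□-assumptions (s ∷ ss) = valid₂ (□-assumption s) (⋀□-assumptions ss) (λ v → ∧-intro)

  ⋀□-boxPremise : ∀ {Σ₀} → All Sg Σ₀ → ∀ Φ Λ Π →
                  ⊢ (⋀ (boxConclusion Φ Λ Π) ⇒ ⋀ (map □ (boxPremise Σ₀ Λ Π)))
  ⋀□-boxPremise {Σ₀} sg Φ Λ Π =
    valid₃ (⋀□-assumptions sg) (⋀-map-⇒ (λ _ → □⁺⇒□) Π) (⋀-map-⇒ (λ _ → □⁺⇒□□⁺) Π)
      (λ v s q₁ q₂ → ⇒-intro (λ c →
        let conc = ⋀⇒All (boxConclusion Φ Λ Π) c
            □Λ   = All.++⁻ˡ (map □ Λ) (All.++⁻ʳ Φ conc)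
            □⁺Π  = All⇒⋀ (map □⁺ Π) (All.++⁻ʳ (map □ Λ) (All.++⁻ʳ Φ conc))
            □Π   = ⋀⇒All (map □ Π) (⇒-elim q₁ □⁺Π)
            □□⁺Π = ⋀⇒All (map (λ x → □ (□⁺ x)) Π) (⇒-elim q₂ □⁺Π)
            □Σ₀  = ⋀⇒All (map □ Σ₀) s
        in All⇒⋀ (map □ (boxPremise Σ₀ Λ Π))
             (All.map⁺ (All.++⁺ (All.map⁻ □Σ₀) (All.++⁺ (All.map⁻ □Λ)
               (All.++⁺ (All.map⁻ □Π) (All.map⁺ (All.map⁻ □□⁺Π))))))))

  □-rule-⇒ : ∀ {Σ₀} → All Sg Σ₀ → ∀ Φ Λ Π {Y} → ⊢ (⋀ (boxPremise Σ₀ Λ Π) ⇒ Y) →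
             ⊢ (⋀ (boxConclusion Φ Λ Π) ⇒ □ Y)
  □-rule-⇒ {Σ₀} sg Φ Λ Π d = ⇒-trans (⋀□-boxPremise sg Φ Λ Π) (□-lift (boxPremise Σ₀ Λ Π) d)

  □-sound : ∀ {Σ₀} → All Sg Σ₀ → ∀ A Φ Λ Π Ψ E →
            ⊢ (⋀ (boxPremise Σ₀ Λ Π) ⇒ ⋁ [ A ]) → ⊢ Seq (boxConclusion Φ Λ Π) (□ A ∷ Ψ) E
  □-sound sg A Φ Λ Π Ψ E d =
    valid₁ (□-rule-⇒ sg Φ Λ Π (valid₁ d (λ v p → ⇒-intro (λ c → ⋁-singleton (⇒-elim p c)))))
      (λ v p → seq-intro (λ c → inj₁ (here (⇒-elim p (All⇒⋀ _ c)))))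

  -- The right premise of (□⁺) is replaced by any X, at the price of the side formula □(A ∧ X).
  □⁺-sound-open : ∀ {Σ₀} → All Sg Σ₀ → ∀ A Φ Λ Π Ψ E X →
                  ⊢ (⋀ (boxPremise Σ₀ Λ Π) ⇒ ⋁ [ A ]) → ⊢ (⋀ (boxPremise Σ₀ Λ Π) ⇒ X) →
                  ⊢ (□ (A ∧' X) ⇒ E) → ⊢ Seq (boxConclusion Φ Λ Π) (□⁺ A ∷ Ψ) E
  □⁺-sound-open sg A Φ Λ Π Ψ E X d e f =
    valid₂ (□-rule-⇒ sg Φ Λ Π (valid₂ d e (λ v p q → ⇒-intro (λ c →
              ∧-intro (⋁-singleton (⇒-elim p c)) (⇒-elim q c)))))
           f
      (λ v p f′ → seq-intro (λ c → inj₂ (⇒-elim f′ (⇒-elim p (All⇒⋀ _ c)))))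

  □⁺-sound : ∀ {Σ₀} → All Sg Σ₀ → ∀ A Φ Λ Π Ψ E →
             ⊢ (⋀ (boxPremise Σ₀ Λ Π) ⇒ ⋁ [ A ]) → ⊢ (⋀ (boxPremise Σ₀ Λ Π) ⇒ ⋁ [ □⁺ A ]) →
             ⊢ Seq (boxConclusion Φ Λ Π) (□⁺ A ∷ Ψ) E
  □⁺-sound sg A Φ Λ Π Ψ E d e =
    valid₁ (□⁺-sound-open sg A Φ Λ Π Ψ (□⁺ A) (□⁺ A) d
              (valid₁ e (λ v p → ⇒-intro (λ c → ⋁-singleton (⇒-elim p c)))) □[∧□⁺]⇒□⁺)
      (λ v p → seq-intro (λ c → inj₁ ([ (λ a → a) , here ]′ (seq-elim p c))))

module Labels where

  ≈ˢ-refl : ∀ {S} → S ≈ˢ S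
  ≈ˢ-refl = ↭-refl , refl , ↭-refl

  ≈ˢ-sym : ∀ {S S′} → S ≈ˢ S′ → S′ ≈ˢ S
  ≈ˢ-sym (a , b , c) = ↭-sym a , sym b , ↭-sym c

  ≈ˢ-trans : ∀ {S S′ S″} → S ≈ˢ S′ → S′ ≈ˢ S″ → S ≈ˢ S″
  ≈ˢ-trans (a , b , c) (a′ , b′ , c′) = ↭-trans a a′ , trans b b′ , ↭-trans c c′

  LabEq-refl : ∀ m → LabEq m m
  LabEq-refl nothing        = tt
  LabEq-refl (just (S , t)) = ≈ˢ-refl , refl

  LabEq-trans : ∀ m m′ m″ → LabEq m m′ → LabEq m′ m″ → LabEq m m″
  LabEq-trans nothing  nothing  nothing  _       _         = tt
  LabEq-trans (just _) (just _) (just _) (a , b) (a′ , b′) = ≈ˢ-trans a a′ , trans b b′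

  LabEq-annAt : ∀ m m′ → LabEq m m′ → annAt m ≡ annAt m′
  LabEq-annAt nothing  nothing  _                 = refl
  LabEq-annAt (just _) (just _) ((_ , e , _) , _) = cong just e

  LabEq-tagAt : ∀ m m′ → LabEq m m′ → tagAt m ≡ tagAt m′
  LabEq-tagAt nothing  nothing  _       = refl
  LabEq-tagAt (just _) (just _) (_ , e) = cong just e

  LabEq-defined : ∀ m m′ → LabEq m m′ → ∃[ L ] (m′ ≡ just L) → ∃[ L ] (m ≡ just L)
  LabEq-defined (just L) (just _) _ _ = L , refl

  LabEq-just : ∀ {S t} m → LabEq (just (S , t)) m → Σ Label λ L → (m ≡ just L) × (S ≈ˢ proj₁ L)
  LabEq-just (just L) (q , _) = L , refl , q

open Labels

module Subtrees (T : Tree) where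

  Iso-root : ∀ {α β} → Iso T α β → LabEq (T α) (T β)
  Iso-root {α} {β} i = subst₂ (λ a b → LabEq (T a) (T b)) (++-identityʳ α) (++-identityʳ β) (i [])

  Iso-++[] : ∀ α → Iso T (α ++ []) α
  Iso-++[] α γ rewrite ++-identityʳ α = LabEq-refl (T (α ++ γ))

  Iso-child : ∀ {α x y} d → Iso T α x → Iso T (x ∷ʳ d) y → Iso T (α ∷ʳ d) y
  Iso-child {α} {x} {y} d i j γ =
    LabEq-trans (T ((α ∷ʳ d) ++ γ)) (T ((x ∷ʳ d) ++ γ)) (T (y ++ γ))
      (subst₂ (λ a b → LabEq (T a) (T b)) (sym (++-assoc α [ d ] γ)) (sym (++-assoc x [ d ] γ))
              (i (d ∷ γ)))
      (j γ)

open Subtrees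

-- The finite graph of representatives: x →d y when the d-th child of x has the subtree of y.
module Walks (T : Tree) (reps : List Addr) where

  Edge : Addr → Fin 2 → Addr → Set
  Edge x d y = Iso T (x ∷ʳ d) y × y ∈ reps × Defined T y

  data Walk : Addr → Addr → Set where
    []  : ∀ {x} → Walk x x
    _∷_ : ∀ {x y z} → (Σ (Fin 2) λ d → Edge x d y) → Walk y z → Walk x z

  _++ʷ_ : ∀ {x y z} → Walk x y → Walk y z → Walk x z
  []      ++ʷ q = q
  (e ∷ w) ++ʷ q = e ∷ (w ++ʷ q)

  ∣_∣ʷ : ∀ {x y} → Walk x y → ℕ
  ∣ []    ∣ʷ = 0
  ∣ _ ∷ w ∣ʷ = suc ∣ w ∣ʷ

  data Box⁺Free : ∀ {x y} → Walk x y → Set where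
    []  : ∀ {x} → Box⁺Free ([] {x})
    _∷_ : ∀ {x y z} {e : Σ (Fin 2) λ d → Edge x d y} {w : Walk y z} →
          (tagAt (T x) ≡ just box⁺ → Empty) → Box⁺Free w → Box⁺Free (e ∷ w)

  -- The step x → y leaves the formula annotation of x: it changes it, or reaches ∘.
  Reset : Addr → Addr → Set
  Reset x y = annAt (T y) ≡ annAt (T x) → annAt (T y) ≡ just ∘

  data HasReset : ∀ {x y} → Walk x y → Set where
    here  : ∀ {x y z} {e : Σ (Fin 2) λ d → Edge x d y} {w : Walk y z} → Reset x y → HasReset (e ∷ w)
    there : ∀ {x y z} {e : Σ (Fin 2) λ d → Edge x d y} {w : Walk y z} → HasReset w → HasReset (e ∷ w)

  Box⁺Free-++ : ∀ {x y z} {p : Walk x y} {q : Walk y z} → Box⁺Free p → Box⁺Free q → Box⁺Free (p ++ʷ q)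
  Box⁺Free-++ []      q = q
  Box⁺Free-++ (t ∷ p) q = t ∷ Box⁺Free-++ p q

  HasReset-++ˡ : ∀ {x y z} {p : Walk x y} (q : Walk y z) → HasReset p → HasReset (p ++ʷ q)
  HasReset-++ˡ q (here r)  = here r
  HasReset-++ˡ q (there h) = there (HasReset-++ˡ q h)

  HasReset-++ʳ : ∀ {x y z} (p : Walk x y) {q : Walk y z} → HasReset q → HasReset (p ++ʷ q)
  HasReset-++ʳ []      h = h
  HasReset-++ʳ (e ∷ p) h = there (HasReset-++ʳ p h)

module Cycles (T : Tree) (reps : List Addr)
              (closed : ∀ α (i : Fin 2) → T α ≡ nothing → T (α ∷ʳ i) ≡ nothing)
              (good : GoodBranches T) where
  open Walks T reps

  _++ˢ_ : List (Fin 2) → (ℕ → Fin 2) → ℕ → Fin 2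
  ([]       ++ˢ g) n       = g n
  ((x ∷ xs) ++ˢ g) zero    = x
  ((x ∷ xs) ++ˢ g) (suc n) = (xs ++ˢ g) n

  prefix-∷ˢ : ∀ x xs g k → prefix ((x ∷ xs) ++ˢ g) (suc k) ≡ x ∷ prefix (xs ++ˢ g) k
  prefix-∷ˢ x xs g zero    = refl
  prefix-∷ˢ x xs g (suc k) = cong (_∷ʳ (xs ++ˢ g) k) (prefix-∷ˢ x xs g k)

  prefix-++ˢ : ∀ xs g n → prefix (xs ++ˢ g) (length xs + n) ≡ xs ++ prefix g n
  prefix-++ˢ []       g n = refl
  prefix-++ˢ (x ∷ xs) g n = trans (prefix-∷ˢ x xs g (length xs + n)) (cong (x ∷_) (prefix-++ˢ xs g n))

  defined-parent : ∀ α i → Defined T (α ∷ʳ i) → Defined T α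
  defined-parent α i (L , eq) with T α in eqα
  ... | just L′ = L′ , refl
  ... | nothing with trans (sym eq) (closed α i eqα)
  ...   | ()

  defined-prefix : ∀ f d n → Defined T (prefix f (d + n)) → Defined T (prefix f n)
  defined-prefix f zero    n p = p
  defined-prefix f (suc d) n p = defined-prefix f d n (defined-parent _ (f (d + n)) p)

  -- Running around the cycle z → y₀ → ⋯ → z forever, below the address z, is an infinite branch of T.
  module Unroll (z : Addr) (dz : Defined T z) {y₀ d₀} (e₀ : Edge z d₀ y₀) (w₀ : Walk y₀ z) where

    State : Set
    State = Σ Addr λ x → Walk x z

    next : State → State
    next (_ , (_ , e) ∷ w) = _ , w
    next (_ , [])          = y₀ , w₀

    out-dir : State → Fin 2
    out-dir (_ , (d , _) ∷ _) = d
    out-dir (_ , [])          = d₀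

    out-edge : ∀ s → Edge (proj₁ s) (out-dir s) (proj₁ (next s))
    out-edge (_ , (_ , e) ∷ _) = e
    out-edge (_ , [])          = e₀

    state : ℕ → State
    state zero    = z , []
    state (suc n) = next (state n)

    dir : ℕ → Fin 2
    dir n = out-dir (state n)

    node : ℕ → Addr
    node n = proj₁ (state n)

    branch : ℕ → Fin 2
    branch = z ++ˢ dir

    node-Iso : ∀ n → Iso T (z ++ prefix dir n) (node n)
    node-Iso zero    = Iso-++[] T z
    node-Iso (suc n) = subst (λ α → Iso T α (node (suc n))) (++-assoc z (prefix dir n) [ dir n ])
      (Iso-child T (dir n) (node-Iso n) (proj₁ (out-edge (state n))))

    node-defined : ∀ n → Defined T (node n)
    node-defined zero    = dz
    node-defined (suc n) = proj₂ (proj₂ (out-edge (state n)))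

    on-branch : ∀ n → LabEq (T (prefix branch (length z + n))) (T (node n))
    on-branch n rewrite prefix-++ˢ z dir n = Iso-root T (node-Iso n)

    branch-defined : ∀ n → Defined T (prefix branch n)
    branch-defined n = defined-prefix branch (length z) n
      (LabEq-defined _ _ (on-branch n) (node-defined n))

    returns : ∀ j {x} (r : Walk x z) → state j ≡ (x , r) → state (j + ∣ r ∣ʷ) ≡ (z , [])
    returns j []      eq = trans (cong state (+-identityʳ j)) eq
    returns j (e ∷ w) eq = trans (cong state (+-suc j ∣ w ∣ʷ)) (returns (suc j) w (cong next eq))

    Box⁺Free-step : Box⁺Free ((d₀ , e₀) ∷ w₀) → ∀ s → Box⁺Free (proj₂ s) →
                    (tagAt (T (proj₁ s)) ≡ just box⁺ → Empty) × Box⁺Free (proj₂ (next s))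
    Box⁺Free-step _       (_ , _ ∷ _) (t ∷ r) = t , r
    Box⁺Free-step (t ∷ r) (_ , [])    _       = t , r

    Box⁺Free-state : Box⁺Free ((d₀ , e₀) ∷ w₀) → ∀ n → Box⁺Free (proj₂ (state n))
    Box⁺Free-state c zero    = []
    Box⁺Free-state c (suc n) = proj₂ (Box⁺Free-step c (state n) (Box⁺Free-state c n))

    Box⁺Free-impossible : Box⁺Free ((d₀ , e₀) ∷ w₀) → Empty
    Box⁺Free-impossible c with good branch branch-defined
    ... | _ , _ , _ , often with often (length z)
    ...   | n , ∣z∣≤n , _ , box⁺-at-n , _ with m≤n⇒∃[o]m+o≡n ∣z∣≤n
    ...     | j , refl = proj₁ (Box⁺Free-step c (state j) (Box⁺Free-state c j))
                           (trans (sym (LabEq-tagAt _ _ (on-branch j))) box⁺-at-n)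

    Reset-impossible : Reset z y₀ → Empty
    Reset-impossible reset with good branch branch-defined
    ... | k , A , constant , _ = fm≢∘ (trans (sym at-y₀) (reset (trans at-y₀ (sym at-z))))
      where
        fm≢∘ : just (fm A) ≡ just ∘ → Empty
        fm≢∘ ()
        j = k + ∣ proj₂ (state k) ∣ʷ
        back : state j ≡ (z , [])
        back = returns k (proj₂ (state k)) refl
        ann-node : ∀ i → k ≤ i → annAt (T (node i)) ≡ just (fm A)
        ann-node i k≤i =
          trans (sym (LabEq-annAt _ _ (on-branch i))) (constant _ (≤-trans k≤i (m≤n+m i (length z))))
        at-z : annAt (T z) ≡ just (fm A)
        at-z = subst (λ s → annAt (T (proj₁ s)) ≡ just (fm A)) back (ann-node j (m≤m+n k _))
        at-y₀ : annAt (T y₀) ≡ just (fm A)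
        at-y₀ = subst (λ s → annAt (T (proj₁ (next s))) ≡ just (fm A)) back
                  (ann-node (suc j) (≤-trans (m≤m+n k _) (n≤1+n j)))

  no-Box⁺Free-cycle : ∀ {z y d} (e : Edge z d y) (w : Walk y z) → Defined T z → Box⁺Free ((d , e) ∷ w) → Empty
  no-Box⁺Free-cycle e w dz = Unroll.Box⁺Free-impossible _ dz e w

  no-Reset-cycle : ∀ {z} → Defined T z → (c : Walk z z) → HasReset c → Empty
  no-Reset-cycle dz c = rotate c dz []
    where
      rotate : ∀ {a b} (w : Walk a b) → Defined T a → Walk b a → HasReset w → Empty
      rotate ((d , e) ∷ w) da acc (here r)  = Unroll.Reset-impossible _ da e (w ++ʷ acc) r
      rotate ((d , e) ∷ w) da acc (there h) = rotate w (proj₂ (proj₂ e)) (acc ++ʷ ((d , e) ∷ [])) h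

_∈[_]_ : ∀ {ℓ} {B : Set ℓ} → Addr → (B → Addr) → List B → Set ℓ
r ∈[ key ] H = Any (λ b → key b ≡ r) H

∈[]? : ∀ {ℓ} {B : Set ℓ} (r : Addr) (key : B → Addr) (H : List B) → Dec (r ∈[ key ] H)
∈[]? r key = any? (λ b → ≡-dec Fin._≟_ (key b) r)

remove : ∀ {A : Set} {x : A} {xs} → x ∈ xs → List A
remove {xs = _ ∷ xs} (here _)  = xs
remove {xs = y ∷ _}  (there p) = y ∷ remove p

length-remove : ∀ {A : Set} {x : A} {xs} (p : x ∈ xs) → suc (length (remove p)) ≡ length xs
length-remove (here _)  = refl
length-remove (there p) = cong suc (length-remove p)

∈-remove : ∀ {A : Set} {x r : A} {xs} (p : x ∈ xs) → r ∈ xs → r ≡ x ⊎ r ∈ remove p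
∈-remove (here refl) (here refl) = inj₁ refl
∈-remove (here refl) (there q)   = inj₂ q
∈-remove (there p)   (here refl) = inj₂ (here refl)
∈-remove (there p)   (there q)   = Sum.map₂ there (∈-remove p q)

module Fuelling (reps : List Addr) where

  Fuel : ∀ {ℓ} {B : Set ℓ} → (B → Addr) → List B → ℕ → Set ℓ
  Fuel key H f = Σ (List Addr) λ rest → (∀ r → r ∈ reps → r ∈[ key ] H ⊎ r ∈ rest) × length rest ≤ f

  Fuel-full : ∀ {ℓ} {B : Set ℓ} {key : B → Addr} → Fuel key [] (length reps)
  Fuel-full = reps , (λ r r∈reps → inj₂ r∈reps) , ≤-refl

  Fuel⁺ : ∀ {ℓ} {B : Set ℓ} → (B → Addr) → List B → Addr → ℕ → Set ℓ
  Fuel⁺ key H u f =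
    Σ (List Addr) λ rest → (∀ r → r ∈ reps → r ∈[ key ] H ⊎ r ≡ u ⊎ r ∈ rest) × length rest ≤ f

  Fuel-empty : ∀ {ℓ} {B : Set ℓ} {key : B → Addr} {H u} → Fuel key H 0 → u ∈ reps → ¬ u ∈[ key ] H → Empty
  Fuel-empty (rest , cover , bound) u∈reps u∉H with cover _ u∈reps
  ... | inj₁ u∈H = u∉H u∈H
  ... | inj₂ p with subst (_≤ 0) (sym (length-remove p)) bound
  ...   | ()

  Fuel-visit : ∀ {ℓ} {B : Set ℓ} {key : B → Addr} {H u f} → Fuel key H (suc f) → u ∈ reps → ¬ u ∈[ key ] H →
               Fuel⁺ key H u f
  Fuel-visit {f = f} (rest , cover , bound) u∈reps u∉H with cover _ u∈reps
  ... | inj₁ u∈H = ⊥-elim (u∉H u∈H)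
  ... | inj₂ p = remove p , cover′ , bound′
    where
      cover′ : ∀ r → r ∈ reps → _
      cover′ r r∈reps = Sum.map₂ (∈-remove p) (cover r r∈reps)
      bound′ : length (remove p) ≤ f
      bound′ with subst (_≤ suc f) (sym (length-remove p)) bound
      ... | s≤s b = b

  Fuel-record : ∀ {ℓ ℓ′} {B : Set ℓ} {B′ : Set ℓ′} {key : B → Addr} {key′ : B′ → Addr} {H H′ u f} →
                Fuel⁺ key H u f → (∀ r → r ∈[ key ] H → r ∈[ key′ ] H′) → u ∈[ key′ ] H′ → Fuel key′ H′ f
  Fuel-record (rest , cover , bound) H⊆H′ u∈H′ = rest , cover′ , bound
    where
      cover′ : ∀ r → r ∈ reps → _
      cover′ r r∈reps with cover r r∈reps
      ... | inj₁ r∈H          = inj₁ (H⊆H′ r r∈H)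
      ... | inj₂ (inj₁ refl)  = inj₁ u∈H′
      ... | inj₂ (inj₂ r∈rest) = inj₂ r∈rest

  Fuel-mono : ∀ {ℓ ℓ′} {B : Set ℓ} {B′ : Set ℓ′} {key : B → Addr} {key′ : B′ → Addr} {H H′ f} →
              Fuel key H f → (∀ r → r ∈[ key ] H → r ∈[ key′ ] H′) → Fuel key′ H′ f
  Fuel-mono (rest , cover , bound) H⊆H′ =
    rest , (λ r r∈reps → Sum.map₁ (H⊆H′ r) (cover r r∈reps)) , bound

module Translation (Sg : Fm → Set) (T : Tree) (lc : LocallyCorrect Sg T) (good : GoodBranches T)
                   (reps : List Addr) (rep : ∀ α → Defined T α → ∃[ β ] (β ∈ reps × Iso T α β)) where
  open Hilbert Sg
  open SequentRules Sg
  open Walks T reps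
  open Cycles T reps (proj₂ lc) good
  open Fuelling reps

  -- The junk value at absent nodes is never used.
  sequentOf : Maybe Label → ASeq
  sequentOf nothing        = ⟨ [] ⇒[ ∘ ] [] ⟩
  sequentOf (just (S , _)) = S

  anteAt succAt : Addr → List Fm
  anteAt y = ante (sequentOf (T y))
  succAt y = succ (sequentOf (T y))

  sequentOf-T : ∀ y {L} → T y ≡ just L → sequentOf (T y) ≡ proj₁ L
  sequentOf-T y eq rewrite eq = refl

  annAt-T : ∀ y {S t} → T y ≡ just (S , t) → annAt (T y) ≡ just (ann S)
  annAt-T y eq rewrite eq = refl

  tagAt-T : ∀ y {S t} → T y ≡ just (S , t) → tagAt (T y) ≡ just t
  tagAt-T y eq rewrite eq = refl

  annAt-sequentOf : ∀ y → Defined T y → annAt (T y) ≡ just (ann (sequentOf (T y)))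
  annAt-sequentOf y (L , eq) = trans (annAt-T y eq) (cong (λ S → just (ann S)) (sym (sequentOf-T y eq)))

  seq-at : ∀ u {S t C E} → T u ≡ just (S , t) → S ≈ˢ C →
           ⊢ Seq (ante C) (succ C) E → ⊢ Seq (anteAt u) (succAt u) E
  seq-at u {E = E} eq S≈C d =
    subst (λ S → ⊢ Seq (ante S) (succ S) E) (sym (sequentOf-T u eq)) (seq-resp-≈ˢ (≈ˢ-sym S≈C) d)

  WF-□⁺ : ∀ S {A} → WF S → ann S ≡ fm A → □⁺ A ∈ succ S
  WF-□⁺ ⟨ Γ ⇒[ fm B ] Δ ⟩ wf refl = wf

  rep-of : ∀ α P → Matches (T α) (just P) →
              ∃[ y ] (Iso T α y × y ∈ reps × Defined T y × sequentOf (T y) ≈ˢ P)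
  rep-of α P m with T α in eq
  ... | just L with rep α (L , eq)
  ...   | β , β∈reps , iso with LabEq-just (T β) (subst (λ m → LabEq m (T β)) eq (Iso-root T iso))
  ...     | L′ , eq′ , L≈L′ =
    β , iso , β∈reps , (L′ , eq′) , subst (_≈ˢ P) (sym (sequentOf-T β eq′)) (≈ˢ-trans (≈ˢ-sym L≈L′) m)

  Provable : Addr → Set₁
  Provable y = ⊢ (⋀ (anteAt y) ⇒ ⋁ (succAt y))

  budFormula : Fm → Addr → Fm
  budFormula A y = ⋀ (anteAt y) ∧' (⋁ (succAt y) ⇒ □⁺ A)

  Bud : Fm → Addr → Set
  Bud A u = Σ Addr λ y → Walk u y × annAt (T y) ≡ just (fm A) × y ∈ reps × Defined T y

  Bud-prepend : ∀ {A x u} → Walk x u → Bud A u → Bud A x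
  Bud-prepend w (y , w′ , a , y∈reps , dy) = y , w ++ʷ w′ , a , y∈reps , dy

  -- A derivation of Γ ⇒ Δ through the A-annotated region above u, left open at the buds: right
  -- premises of (□⁺) annotated A, whose obligations □(A ∧ budFormula) are collected in the disjunct E.
  record OpenDerivation (A : Fm) (u : Addr) (Γ Δ : List Fm) : Set₁ where
    constructor opened
    field
      buds      : List (Bud A u)
      annotated : All (λ _ → annAt (T u) ≡ just (fm A)) buds
      close     : ∀ E → All (λ b → ⊢ (□ (A ∧' budFormula A (proj₁ b)) ⇒ E)) buds → ⊢ Seq Γ Δ E
  open OpenDerivation

  OpenDerivationAt : Fm → Addr → Set₁
  OpenDerivationAt A u = OpenDerivation A u (anteAt u) (succAt u)

  AnnotatedBy : Fm → Addr → Set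
  AnnotatedBy A u = annAt (T u) ≡ just (fm A) ⊎ annAt (T u) ≡ just ∘

  -- Closing such a walk into a cycle contradicts GoodBranches.
  Unproductive : ∀ {a b} → Walk a b → Set
  Unproductive w = Box⁺Free w ⊎ HasReset w

  Ancestor : Addr → Set
  Ancestor u = Σ Addr λ h → Σ (Fin 2) λ d → Σ Addr λ y → Σ (Edge h d y) λ e → Σ (Walk y u) λ w →
    Unproductive ((d , e) ∷ w)

  ResetAncestor : Addr → Set
  ResetAncestor u = Σ Addr λ h → Σ (Fin 2) λ d → Σ Addr λ y → Σ (Edge h d y) λ e → Σ (Walk y u) λ w →
    HasReset ((d , e) ∷ w)

  Unproductive-++ : ∀ {h d y u u′} {e : Edge h d y} {w : Walk y u} {q : Walk u u′} →
                    Unproductive ((d , e) ∷ w) → Unproductive q → Unproductive ((d , e) ∷ (w ++ʷ q))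
  Unproductive-++             (inj₁ b) (inj₁ b′) = inj₁ (Box⁺Free-++ b b′)
  Unproductive-++ {d = d} {e = e} {w = w} (inj₁ _) (inj₂ r) = inj₂ (HasReset-++ʳ ((d , e) ∷ w) r)
  Unproductive-++ {q = q}     (inj₂ r) _         = inj₂ (HasReset-++ˡ q r)

  Ancestor-extend : ∀ {u u′} (q : Walk u u′) → Unproductive q → Ancestor u → Ancestor u′
  Ancestor-extend q uq (h , d , y , e , w , uw) = h , d , y , e , w ++ʷ q , Unproductive-++ uw uq

  ResetAncestor-extend : ∀ {u u′} (q : Walk u u′) → ResetAncestor u → ResetAncestor u′
  ResetAncestor-extend q (h , d , y , e , w , r) = h , d , y , e , w ++ʷ q , HasReset-++ˡ q r

  ResetAncestor-via : ∀ {u u′} (q : Walk u u′) → HasReset q → Ancestor u → ResetAncestor u′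
  ResetAncestor-via q r (h , d , y , e , w , _) = h , d , y , e , w ++ʷ q , HasReset-++ʳ ((d , e) ∷ w) r

  forget-reset : ∀ {u} → ResetAncestor u → Ancestor u
  forget-reset (h , d , y , e , w , r) = h , d , y , e , w , inj₂ r

  ancestors-step : ∀ {u y d} (H : List (Ancestor u)) (e : Edge u d y) → Box⁺Free ((d , e) ∷ []) → List (Ancestor y)
  ancestors-step {u} H e b = (u , _ , _ , e , [] , inj₁ b) ∷ map (Ancestor-extend ((_ , e) ∷ []) (inj₁ b)) H

  ancestors-reset : ∀ {u y d} (H : List (Ancestor u)) (e : Edge u d y) → Reset u y → List (ResetAncestor y)
  ancestors-reset {u} H e r = (u , _ , _ , e , [] , here r) ∷ map (ResetAncestor-via ((_ , e) ∷ []) (here r)) H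

  not-own-ancestor : ∀ {y} (H : List (Ancestor y)) → y ∈[ proj₁ ] H → Defined T y → Empty
  not-own-ancestor H y∈H dy with satisfied y∈H
  ... | (h , d , _ , e , w , inj₁ b) , refl = no-Box⁺Free-cycle e w dy b
  ... | (h , d , _ , e , w , inj₂ r) , refl = no-Reset-cycle dy ((d , e) ∷ w) r

  Discharged : Fm → Set₁
  Discharged A = Σ Addr (OpenDerivationAt A)

  Covered : ∀ {A x} → List (Discharged A) → List (Bud A x) → Set₁
  Covered D P = All (λ de → All (λ b → proj₁ b ∈[ proj₁ ] D ⊎ proj₁ b ∈[ proj₁ ] P) (buds (proj₂ de))) D

  Saturated : Fm → Addr → Set₁
  Saturated A x = Σ (List (Discharged A)) λ D → Covered {x = x} D [] × x ∈[ proj₁ ] D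

  -- All of D share the loop invariant ⋁ (budFormula A y, y ∈ D), which □⁺-from-loop discharges.
  close-loop : ∀ A x → Saturated A x → □⁺ A ∈ succAt x → Provable x
  close-loop A x (D , covered , x∈D) □⁺A∈Δ = at-x {Any.lookup x∈D} (All.lookupAny open-with-L x∈D)
    where
      budFormulas : List Fm
      budFormulas = map (λ de → budFormula A (proj₁ de)) D
      L : Fm
      L = ⋁ budFormulas
      ⇒L : ∀ y → y ∈[ proj₁ ] D → ⊢ (budFormula A y ⇒ L)
      ⇒L y y∈D = valid (λ v → ⇒-intro (λ p →
        Any⇒⋁ budFormulas (Any.map⁺ (Any.map (λ { refl → p }) y∈D))))
      □-⇒L : ∀ {y} → y ∈[ proj₁ ] D ⊎ y ∈[ proj₁ ] [] → ⊢ (□ (A ∧' budFormula A y) ⇒ □ (A ∧' L))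
      □-⇒L (inj₁ y∈D) = □-mono (valid₁ (⇒L _ y∈D) (λ v q → ⇒-intro (λ c →
        ∧-intro (∧-proj₁ c) (⇒-elim q (∧-proj₂ A c)))))
      open-with-L : All (λ de → ⊢ Seq (anteAt (proj₁ de)) (succAt (proj₁ de)) (□ (A ∧' L))) D
      open-with-L = All.map (λ {de} c → close (proj₂ de) (□ (A ∧' L)) (All.map □-⇒L c)) covered
      at-x : ∀ {de : Discharged A} →
             ⊢ Seq (anteAt (proj₁ de)) (succAt (proj₁ de)) (□ (A ∧' L)) × proj₁ de ≡ x → Provable x
      at-x (open-x , refl) =
        seq-absorb □⁺A∈Δ open-x (□⁺-from-loop A budFormulas (All.map⁺ (All.map seq-guard open-with-L)))

  annAt-rule : ∀ u {S t C} → T u ≡ just (S , t) → S ≈ˢ C → annAt (T u) ≡ just (ann C)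
  annAt-rule u eqT S≈C = trans (annAt-T u eqT) (cong just (proj₁ (proj₂ S≈C)))

  tag-not-box⁺ : ∀ u {S t} → T u ≡ just (S , t) → ¬ t ≡ box⁺ → ¬ tagAt (T u) ≡ just box⁺
  tag-not-box⁺ u eqT t≢box⁺ e = t≢box⁺ (just-injective (trans (sym (tagAt-T u eqT)) e))

  annotation-formula : ∀ {A A′ u} → annAt (T u) ≡ just (fm A′) → AnnotatedBy A u → A′ ≡ A
  annotation-formula ann-u (inj₁ e) with trans (sym ann-u) e
  ... | refl = refl
  annotation-formula ann-u (inj₂ e) with trans (sym ann-u) e
  ... | ()

  open-combine : ∀ {A u Γ₀ Δ₀ Γ₁ Δ₁ Γ Δ} → OpenDerivation A u Γ₀ Δ₀ → OpenDerivation A u Γ₁ Δ₁ →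
                 (∀ E → ⊢ Seq Γ₀ Δ₀ E → ⊢ Seq Γ₁ Δ₁ E → ⊢ Seq Γ Δ E) → OpenDerivation A u Γ Δ
  open-combine (opened buds₀ anns₀ open₀) (opened buds₁ anns₁ open₁) rule =
    opened (buds₀ ++ buds₁) (All.++⁺ anns₀ anns₁)
      λ E closed → rule E (open₀ E (All.++⁻ˡ buds₀ closed)) (open₁ E (All.++⁻ʳ buds₀ closed))

  open-map : ∀ {A u Γ₀ Δ₀ Γ Δ} → OpenDerivation A u Γ₀ Δ₀ → (∀ E → ⊢ Seq Γ₀ Δ₀ E → ⊢ Seq Γ Δ E) →
             OpenDerivation A u Γ Δ
  open-map (opened buds anns open₀) rule = opened buds anns λ E closed → rule E (open₀ E closed)

  closed-open : ∀ {A u Γ Δ} → (∀ E → ⊢ Seq Γ Δ E) → OpenDerivation A u Γ Δ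
  closed-open derive = opened [] [] λ E _ → derive E

  □⁺-bud : ∀ A u {S t Σ₀} → T u ≡ just (S , t) → AnnotatedBy A u → All Sg Σ₀ → ∀ A′ Φ Λ Π Ψ →
           S ≈ˢ ⟨ boxConclusion Φ Λ Π ⇒[ fm A′ ] □⁺ A′ ∷ Ψ ⟩ →
           Matches (T (u ∷ʳ suc zero)) (just ⟨ boxPremise Σ₀ Λ Π ⇒[ fm A′ ] [ □⁺ A′ ] ⟩) →
           ⊢ (⋀ (boxPremise Σ₀ Λ Π) ⇒ ⋁ [ A′ ]) → OpenDerivationAt A u
  □⁺-bud A u {Σ₀ = Σ₀} eqT within sg A′ Φ Λ Π Ψ S≈C right left
    with annotation-formula (annAt-rule u eqT S≈C) within | rep-of (u ∷ʳ suc zero) _ right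
  ... | refl | y , iso , y∈reps , dy , (Γ↭ , ann≡ , Δ↭) =
    opened ((y , (suc zero , iso , y∈reps , dy) ∷ [] , ann-y , y∈reps , dy) ∷ []) (annAt-rule u eqT S≈C ∷ [])
      λ { E (c ∷ []) → seq-at u eqT S≈C (□⁺-sound-open sg A Φ Λ Π Ψ E (budFormula A y) left premise⇒bud c) }
    where
      ann-y : annAt (T y) ≡ just (fm A)
      ann-y = trans (annAt-sequentOf y dy) (cong just ann≡)
      premise⇒bud : ⊢ (⋀ (boxPremise Σ₀ Λ Π) ⇒ budFormula A y)
      premise⇒bud = valid (λ v → ⇒-intro (λ g →
        ∧-intro (All⇒⋀ (anteAt y) (All-resp-↭ (↭-sym Γ↭) (⋀⇒All (boxPremise Σ₀ Λ Π) g)))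
                (⇒-intro (λ q → ⋁-singleton (Any⇒⋁ [ □⁺ A ] (Any-resp-↭ Δ↭ (⋁⇒Any (succAt y) q)))))))

  -- The fuel (the representatives not yet on the current path) decreases at every rule application;
  -- revisiting a representative on the path would close an unproductive cycle.
  mutual
    open-derivation : ∀ f A u (H : List (Ancestor u)) → Fuel proj₁ H f → ¬ u ∈[ proj₁ ] H → u ∈ reps →
                      Defined T u → AnnotatedBy A u → OpenDerivationAt A u
    open-derivation zero    A u H fuel u∉H u∈reps du within = ⊥-elim (Fuel-empty fuel u∈reps u∉H)
    open-derivation (suc f) A u H fuel u∉H u∈reps ((S , t) , eqT) within with proj₁ lc u S t eqT
    ... | _ , C , Ps , rule , S≈C , children =
      open-by-rule f A u H (Fuel-visit fuel u∈reps u∉H) eqT within rule S≈C children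

    open-by-rule : ∀ f A u (H : List (Ancestor u)) → Fuel⁺ proj₁ H u f → ∀ {S t C Ps} → T u ≡ just (S , t) →
                   AnnotatedBy A u → Rule Sg t C Ps → S ≈ˢ C →
                   (∀ (i : Fin 2) → Matches (T (u ∷ʳ i)) (nth Ps (toℕ i))) → OpenDerivationAt A u
    open-by-rule f A u H fuel eqT within (initp n Γ Δ s) S≈C children =
      closed-open (λ E → seq-at u eqT S≈C (init-var-sound n Γ Δ E))
    open-by-rule f A u H fuel eqT within (init⊥ Γ Δ s) S≈C children =
      closed-open (λ E → seq-at u eqT S≈C (init-⊥-sound Γ Δ E))
    open-by-rule f A u H fuel eqT within (→L A′ B Γ Δ s) S≈C children =
      open-combine (open-child f A u H fuel eqT (λ ()) S≈C within zero (children zero) refl)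
                   (open-child f A u H fuel eqT (λ ()) S≈C within (suc zero) (children (suc zero)) refl)
                   (λ E p q → seq-at u eqT S≈C (→L-sound p q))
    open-by-rule f A u H fuel eqT within (→R A′ B Γ Δ s) S≈C children =
      open-map (open-child f A u H fuel eqT (λ ()) S≈C within zero (children zero) refl)
               (λ E p → seq-at u eqT S≈C (→R-sound p))
    open-by-rule f A u H fuel eqT within (cutR A′ Γ Δ s) S≈C children =
      open-combine (open-child f A u H fuel eqT (λ ()) S≈C within zero (children zero) refl)
                   (open-child f A u H fuel eqT (λ ()) S≈C within (suc zero) (children (suc zero)) refl)
                   (λ E p q → seq-at u eqT S≈C (cut-sound p q))
    open-by-rule f A u H fuel eqT within (□R Σ₀ sg _ A′ Φ Λ Π Ψ s) S≈C children =
      closed-open (λ E → seq-at u eqT S≈C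
        (□-sound sg A′ Φ Λ Π Ψ E (provable-child f u H fuel zero (children zero) (inj₁ refl))))
    open-by-rule f A u H fuel eqT within (□⁺R Σ₀ sg _ A′ Φ Λ Π Ψ s) S≈C children with s ≟fm A′
    ... | no s≢A′ =
      closed-open (λ E → seq-at u eqT S≈C (□⁺-sound sg A′ Φ Λ Π Ψ E
        (provable-child f u H fuel zero (children zero) (inj₁ refl))
        (provable-child f u H fuel (suc zero) (children (suc zero))
          (inj₂ λ e → s≢A′ (just-injective (trans (sym (annAt-rule u eqT S≈C)) e))))))
    ... | yes refl = □⁺-bud A u eqT within sg A′ Φ Λ Π Ψ S≈C (children (suc zero))
                       (provable-child f u H fuel zero (children zero) (inj₁ refl))

    open-child : ∀ f A u (H : List (Ancestor u)) → Fuel⁺ proj₁ H u f → ∀ {S t C} → T u ≡ just (S , t) →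
                 ¬ t ≡ box⁺ → S ≈ˢ C → AnnotatedBy A u → ∀ d {P} → Matches (T (u ∷ʳ d)) (just P) →
                 ann P ≡ ann C → OpenDerivation A u (ante P) (succ P)
    open-child f A u H fuel eqT t≢box⁺ S≈C within d {P} m P≡C with rep-of (u ∷ʳ d) P m
    ... | y , iso , y∈reps , dy , y≈P
      with ∈[]? y proj₁ (ancestors-step H (iso , y∈reps , dy) (tag-not-box⁺ u eqT t≢box⁺ ∷ []))
    ...   | yes y∈H = ⊥-elim (not-own-ancestor _ y∈H dy)
    ...   | no y∉H =
      let opened buds anns derive =
            open-derivation f A y _ (Fuel-record fuel (λ _ r∈H → there (Any.map⁺ r∈H)) (here refl)) y∉H y∈reps dy
              (subst (λ a → a ≡ just (fm A) ⊎ a ≡ just ∘) (sym same-ann) within)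
      in opened (map (Bud-prepend ((d , iso , y∈reps , dy) ∷ [])) buds)
                (All.map⁺ (All.map (trans (sym same-ann)) anns))
           λ E closed → seq-resp-≈ˢ y≈P (derive E (All.map⁻ closed))
      where
        same-ann : annAt (T y) ≡ annAt (T u)
        same-ann = trans (annAt-sequentOf y dy)
                     (trans (cong just (trans (proj₁ (proj₂ y≈P)) P≡C)) (sym (annAt-rule u eqT S≈C)))

    provable-child : ∀ f u (H : List (Ancestor u)) → Fuel⁺ proj₁ H u f → ∀ d {P} →
                     Matches (T (u ∷ʳ d)) (just P) → ann P ≡ ∘ ⊎ ¬ annAt (T u) ≡ just (ann P) →
                     ⊢ (⋀ (ante P) ⇒ ⋁ (succ P))
    provable-child f u H fuel d {P} m resets with rep-of (u ∷ʳ d) P m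
    ... | y , iso , y∈reps , dy , (Γ↭ , ann≡ , Δ↭) =
      ⋀⇒⋁-resp-↭ Γ↭ Δ↭ (provable f y (ancestors-reset H (iso , y∈reps , dy) reset)
                           (Fuel-record fuel (λ _ r∈H → there (Any.map⁺ r∈H)) (here refl)) y∈reps dy)
      where
        ann-y : annAt (T y) ≡ just (ann P)
        ann-y = trans (annAt-sequentOf y dy) (cong just ann≡)
        reset : Reset u y
        reset eq = [ (λ p → trans ann-y (cong just p)) , (λ ne → ⊥-elim (ne (trans (sym eq) ann-y))) ]′ resets

    provable : ∀ f x (H : List (ResetAncestor x)) → Fuel proj₁ H f → x ∈ reps → Defined T x → Provable x
    provable f x H fuel x∈reps ((S , t) , eqT) with ann S in eqS
    ... | ∘ = provable-∘ f x H fuel x∈reps ((S , t) , eqT) (trans (annAt-T x eqT) (cong just eqS))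
    ... | fm A = close-loop A x
      (saturate f A x H fuel (length reps) ((x , [] , ann-x , x∈reps , (S , t) , eqT) ∷ [])
                [] Fuel-full [] (inj₂ (here refl)))
      (subst (λ S → □⁺ A ∈ succ S) (sym (sequentOf-T x eqT)) (WF-□⁺ S (proj₁ (proj₁ lc x S t eqT)) eqS))
      where
        ann-x : annAt (T x) ≡ just (fm A)
        ann-x = trans (annAt-T x eqT) (cong just eqS)

    provable-∘ : ∀ f x (H : List (ResetAncestor x)) → Fuel proj₁ H f → x ∈ reps → Defined T x →
                 annAt (T x) ≡ just ∘ → Provable x
    provable-∘ f x H fuel x∈reps dx ann∘ with ∈[]? x proj₁ (map forget-reset H)
    ... | yes x∈H = ⊥-elim (not-own-ancestor _ x∈H dx)
    ... | no x∉H
      with open-derivation f ⊥' x (map forget-reset H) (Fuel-mono fuel (λ r → Any.map⁺)) x∉H x∈reps dx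
             (inj₂ ann∘)
    ...   | opened [] _ derive = seq-⊥ (derive ⊥' [])
    ...   | opened (_ ∷ _) (ann-fm ∷ _) _ with trans (sym ann-fm) ann∘
    ...     | ()

    saturate : ∀ f A x (H : List (ResetAncestor x)) → Fuel proj₁ H f →
               ∀ n (P : List (Bud A x)) (D : List (Discharged A)) → Fuel proj₁ D n → Covered D P →
               x ∈[ proj₁ ] D ⊎ x ∈[ proj₁ ] P → Saturated A x
    saturate f A x H fuel n [] D fuelD covered x∈ = D , covered , [ (λ x∈D → x∈D) , (λ ()) ]′ x∈
    saturate f A x H fuel n (b ∷ P) D fuelD covered x∈ with ∈[]? (proj₁ b) proj₁ D
    ... | yes b∈D = saturate f A x H fuel n P D fuelD (All.map (All.map skip) covered) (skip x∈)
      where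
        skip : ∀ {y} → y ∈[ proj₁ ] D ⊎ y ∈[ proj₁ ] (b ∷ P) → y ∈[ proj₁ ] D ⊎ y ∈[ proj₁ ] P
        skip (inj₁ y∈D)          = inj₁ y∈D
        skip (inj₂ (here refl))  = inj₁ b∈D
        skip (inj₂ (there y∈P))  = inj₂ y∈P
    ... | no b∉D = discharge f A x H fuel n b P D fuelD covered x∈ b∉D

    discharge : ∀ f A x (H : List (ResetAncestor x)) → Fuel proj₁ H f →
                ∀ n (b : Bud A x) (P : List (Bud A x)) (D : List (Discharged A)) → Fuel proj₁ D n →
                Covered D (b ∷ P) → x ∈[ proj₁ ] D ⊎ x ∈[ proj₁ ] (b ∷ P) → ¬ proj₁ b ∈[ proj₁ ] D →
                Saturated A x
    discharge f A x H fuel zero (u , w , ann-u , u∈reps , du) P D fuelD covered x∈ u∉D =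
      ⊥-elim (Fuel-empty fuelD u∈reps u∉D)
    discharge f A x H fuel (suc n) (u , w , ann-u , u∈reps , du) P D fuelD covered x∈ u∉D
      with ∈[]? u proj₁ (map (λ a → forget-reset (ResetAncestor-extend w a)) H)
    ... | yes u∈H = ⊥-elim (not-own-ancestor _ u∈H du)
    ... | no u∉H =
      saturate f A x H fuel n P′ D′
        (Fuel-record (Fuel-visit fuelD u∈reps u∉D) (λ r → there) (here refl))
        (All.map (λ b∈P′ → inj₂ (Any.++⁺ʳ P b∈P′)) buds-pending ∷ All.map (All.map move) covered) (move x∈)
      where
        derivation : OpenDerivationAt A u
        derivation = open-derivation f A u _ (Fuel-mono fuel (λ r → Any.map⁺)) u∉H u∈reps du (inj₁ ann-u)
        D′ : List (Discharged A)
        D′ = (u , derivation) ∷ D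
        P′ : List (Bud A x)
        P′ = P ++ map (Bud-prepend w) (buds derivation)
        move : ∀ {y} → y ∈[ proj₁ ] D ⊎ y ∈[ proj₁ ] ((u , w , ann-u , u∈reps , du) ∷ P) →
               y ∈[ proj₁ ] D′ ⊎ y ∈[ proj₁ ] P′
        move (inj₁ y∈D)         = inj₁ (there y∈D)
        move (inj₂ (here refl)) = inj₁ (here refl)
        move (inj₂ (there y∈P)) = inj₂ (Any.++⁺ˡ y∈P)
        buds-pending : All (λ c → proj₁ c ∈[ proj₁ ] map (Bud-prepend w) (buds derivation)) (buds derivation)
        buds-pending = All.tabulate (λ c∈buds → Any.map⁺ (Any.map (λ { refl → refl }) c∈buds))

  provable-root : ∀ {R t} → T [] ≡ just (R , t) → ⊢ (⋀ (ante R) ⇒ ⋁ (succ R))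
  provable-root {R} root with rep-of [] R (subst (λ m → Matches m (just R)) (sym root) ≈ˢ-refl)
  ... | r , _ , r∈reps , dr , (Γ↭ , _ , Δ↭) =
    ⋀⇒⋁-resp-↭ Γ↭ Δ↭ (provable (length reps) r [] Fuel-full r∈reps dr)

lemma26 : (Sg : Fm → Set) (Γ Δ : List Fm) (s : Ann) →
    WF ⟨ Γ ⇒[ s ] Δ ⟩ →
    (T : Tree) → ∞Proof Sg ⟨ Γ ⇒[ s ] Δ ⟩ T → Regular T →
    Sg ︔ ∅ ⊢ (⋀ Γ ⇒ ⋁ Δ)
lemma26 Sg Γ Δ s _ T ((_ , root) , correct , good) (reps , rep) =
  Translation.provable-root Sg T correct good reps rep root
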